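{- Let $\mathbf A\in\mathcal V_n$ and let $\sigma$ be a linear congruence on $\mathbf A$ with $\sigma^*=A^2$. Then $\mathbf A/\sigma\cong\mathbf Z_p$ for some prime $p$.
   Context: $\mathcal V_n$ is the class of finite algebras with a single $n$-ary basic operation $w$ that is an idempotent special WNU: $w(x,\dots,x)=x$, $w(y,x,\dots,x)=\dots=w(x,\dots,x,y)$, $w(x,\dots,x,y)=w(x,\dots,x,w(x,\dots,x,y))$. $\mathbf Z_p$ is the algebra on $\{0,\dots,p-1\}$ with operation $w(y_1,\dots,y_n)=y_1+\dots+y_n\pmod p$. A congruence $\sigma$ is irreducible if it is not an intersection of binary subalgebras of $\mathbf A^2$ stable under $\sigma$ (closed under changing any entry within its $\sigma$-class) and different from $\sigma$; then $\sigma^*$ is the minimal $\delta\le\mathbf A^2$, $\delta\supsetneq\sigma$, stable under $\sigma$. An irreducible $\sigma$ is linear if $\sigma^*$ is a congruence and there exist a prime $p$ and $S\le\mathbf A^4$, with all entries of each tuple pairwise $\sigma^*$-related, such that for every $\sigma^*$-block $E$ there is $k\ge0$ with $(E/\sigma;\{(a_1/\sigma,\dots,a_4/\sigma):(a_1,\dots,a_4)\in S\cap E^4\})\cong(\mathbb Z_p^k;x_1-x_2=x_3-x_4)$. -}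

module Defs where

open import Data.Nat using (ℕ; zero; suc; _+_; _∸_; NonZero)
open import Data.Nat.DivMod using (_mod_)
open import Data.Nat.Primality using (Prime; prime⇒nonZero)
open import Data.Fin using (Fin; toℕ; _≟_)
open import Data.Vec using (Vec; lookup)
open import Data.Bool using (Bool; true; false; if_then_else_)
open import Data.Product using (Σ; _×_; _,_; ∃)
open import Relation.Nullary using (¬_)
open import Relation.Nullary.Decidable using (⌊_⌋)
open import Relation.Binary.PropositionalEquality using (_≡_)

-- A finite algebra is (up to isomorphism) given by a
-- carrier Fin m and a single n-ary operation w : (Fin n → Fin m) → Fin m.

Op : ℕ → ℕ → Set
Op n m = (Fin n → Fin m) → Fin m

at : ∀ {n} {A : Set} → A → Fin n → A → Fin n → A
at x i y j = if ⌊ j ≟ i ⌋ then y else x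

record InV (n m : ℕ) (w : Op n m) : Set where
  field
    idem    : ∀ x → w (λ _ → x) ≡ x
    wnu     : ∀ x y (i j : Fin n) → w (at x i y) ≡ w (at x j y)
    -- w(x,...,x,y) = w(x,...,x,w(x,...,x,y)) ; i is the last position
    special : ∀ x y (i : Fin n) → suc (toℕ i) ≡ n →
              w (at x i y) ≡ w (at x i (w (at x i y)))

Rel₂ : ℕ → Set
Rel₂ m = Fin m → Fin m → Bool

Rel₄ : ℕ → Set
Rel₄ m = Fin m → Fin m → Fin m → Fin m → Bool

_⊆₂_ : ∀ {m} → Rel₂ m → Rel₂ m → Set
R ⊆₂ T = ∀ x y → R x y ≡ true → T x y ≡ true

IsSub₂ : ∀ {n m} → Op n m → Rel₂ m → Set
IsSub₂ {n} {m} w R = ∀ (a b : Fin n → Fin m) →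
  (∀ i → R (a i) (b i) ≡ true) → R (w a) (w b) ≡ true

IsSub₄ : ∀ {n m} → Op n m → Rel₄ m → Set
IsSub₄ {n} {m} w S = ∀ (a b c d : Fin n → Fin m) →
  (∀ i → S (a i) (b i) (c i) (d i) ≡ true) → S (w a) (w b) (w c) (w d) ≡ true

record IsCongruence {n m : ℕ} (w : Op n m) (σ : Rel₂ m) : Set where
  field
    refl  : ∀ x → σ x x ≡ true
    sym   : ∀ x y → σ x y ≡ true → σ y x ≡ true
    trans : ∀ x y z → σ x y ≡ true → σ y z ≡ true → σ x z ≡ true
    compatible : IsSub₂ w σ

Stable : ∀ {m} → Rel₂ m → Rel₂ m → Set
Stable σ R = ∀ x y x' y' → σ x x' ≡ true → σ y y' ≡ true →
  R x y ≡ true → R x' y' ≡ true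

Irreducible : ∀ {n m} → Op n m → Rel₂ m → Set₁
Irreducible {n} {m} w σ = ¬ (Σ Set λ I → Σ (I → Rel₂ m) λ R →
    (∀ i → IsSub₂ w (R i)) × (∀ i → Stable σ (R i)) ×
    (∀ i → ¬ (R i ⊆₂ σ × σ ⊆₂ R i)) ×
    (∀ x y → (σ x y ≡ true → ∀ i → R i x y ≡ true) ×
             ((∀ i → R i x y ≡ true) → σ x y ≡ true)))

IsStar : ∀ {n m} → Op n m → Rel₂ m → Rel₂ m → Set
IsStar w σ δ = IsSub₂ w δ × Stable σ δ × σ ⊆₂ δ × ¬ (δ ⊆₂ σ) ×
  (∀ δ' → IsSub₂ w δ' → Stable σ δ' → σ ⊆₂ δ' → ¬ (δ' ⊆₂ σ) →
     δ' ⊆₂ δ → δ ⊆₂ δ')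

zsub : (p : ℕ) → .{{NonZero p}} → Fin p → Fin p → Fin p
zsub p a b = (toℕ a + (p ∸ toℕ b)) mod p

-- The structure (E/σ ; {(a₁/σ,…,a₄/σ) : a ∈ S ∩ E⁴}) is isomorphic to
-- (Z_p^k ; x₁ - x₂ = x₃ - x₄), where E = {x | δ e x} is the δ-block of e.
-- E/σ is rendered as the setoid (E, σ); φ is the isomorphism.
BlockIso : ∀ {m} → Rel₂ m → Rel₂ m → Rel₄ m → Fin m →
           (p : ℕ) → Prime p → ℕ → Set
BlockIso {m} σ δ S e p pr k =
  Σ (Fin m → Vec (Fin p) k) λ φ →
    (∀ x y → δ e x ≡ true → δ e y ≡ true → σ x y ≡ true → φ x ≡ φ y) ×
    (∀ x y → δ e x ≡ true → δ e y ≡ true → φ x ≡ φ y → σ x y ≡ true) ×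
    (∀ v → ∃ λ x → δ e x ≡ true × φ x ≡ v) ×
    (∀ a₁ a₂ a₃ a₄ → δ e a₁ ≡ true → δ e a₂ ≡ true →
                     δ e a₃ ≡ true → δ e a₄ ≡ true →
      ((∃ λ b₁ → ∃ λ b₂ → ∃ λ b₃ → ∃ λ b₄ →
          δ e b₁ ≡ true × δ e b₂ ≡ true × δ e b₃ ≡ true × δ e b₄ ≡ true ×
          σ a₁ b₁ ≡ true × σ a₂ b₂ ≡ true × σ a₃ b₃ ≡ true × σ a₄ b₄ ≡ true ×
          S b₁ b₂ b₃ b₄ ≡ true)
        → ∀ j → zsub p {{prime⇒nonZero pr}} (lookup (φ a₁) j) (lookup (φ a₂) j)
              ≡ zsub p {{prime⇒nonZero pr}} (lookup (φ a₃) j) (lookup (φ a₄) j)) ×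
      ((∀ j → zsub p {{prime⇒nonZero pr}} (lookup (φ a₁) j) (lookup (φ a₂) j)
              ≡ zsub p {{prime⇒nonZero pr}} (lookup (φ a₃) j) (lookup (φ a₄) j))
        → ∃ λ b₁ → ∃ λ b₂ → ∃ λ b₃ → ∃ λ b₄ →
          δ e b₁ ≡ true × δ e b₂ ≡ true × δ e b₃ ≡ true × δ e b₄ ≡ true ×
          σ a₁ b₁ ≡ true × σ a₂ b₂ ≡ true × σ a₃ b₃ ≡ true × σ a₄ b₄ ≡ true ×
          S b₁ b₂ b₃ b₄ ≡ true))

Linear : ∀ {n m} → Op n m → Rel₂ m → Rel₂ m → Set₁
Linear {n} {m} w σ δ =
  Irreducible w σ × IsStar w σ δ × IsCongruence w δ ×
  Σ ℕ λ p → Σ (Prime p) λ pr → Σ (Rel₄ m) λ S →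
    IsSub₄ w S ×
    (∀ a₁ a₂ a₃ a₄ → S a₁ a₂ a₃ a₄ ≡ true →
       δ a₁ a₂ ≡ true × δ a₁ a₃ ≡ true × δ a₁ a₄ ≡ true ×
       δ a₂ a₃ ≡ true × δ a₂ a₄ ≡ true × δ a₃ a₄ ≡ true) ×
    (∀ e → Σ ℕ λ k → BlockIso σ δ S e p pr k)

sumFin : ∀ n → (Fin n → ℕ) → ℕ
sumFin zero    f = 0
sumFin (suc n) f = f Fin.zero + sumFin n (λ i → f (Fin.suc i))

zpOp : ∀ {n} (p : ℕ) → .{{NonZero p}} → Op n p
zpOp {n} p ys = sumFin n (λ i → toℕ (ys i)) mod p

-- A/σ ≅ Z_p, with A/σ rendered as the setoid algebra (Fin m, σ, w)
QuotIsoZp : ∀ {n m} → Op n m → Rel₂ m → (p : ℕ) → Prime p → Set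
QuotIsoZp {n} {m} w σ p pr = Σ (Fin m → Fin p) λ f →
  (∀ x y → σ x y ≡ true → f x ≡ f y) ×
  (∀ x y → f x ≡ f y → σ x y ≡ true) ×
  (∀ v → ∃ λ x → f x ≡ v) ×
  (∀ (a : Fin n → Fin m) → f (w a) ≡ zpOp p {{prime⇒nonZero pr}} (λ i → f (a i)))

-- Since σ* is total, the block isomorphism gives coordinates φ : A → ℤₚᵏ, inverting σ, in which
-- the σ-saturation of the subalgebra S is the relation x₁ − x₂ = x₃ − x₄; so w preserves that
-- relation coordinatewise. For such a coordinate f, with z a preimage of 0 and L y = w(z,…,z,y),
-- comparing u with u[i := z] against the constant tuple z̄ splits off one argument at a time:
-- f (w u) = Σᵢ f (L uᵢ). Idempotence gives f y = f (L y) + ⋯ + f (L y), and speciality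
-- (L ∘ L = L) then f ∘ L = f, so every coordinate turns w into the ℤₚ-sum. With k = 1 the
-- coordinate is the isomorphism A/σ ≅ ℤₚ; k = 0 would make σ total, i.e. σ = σ*; and for k ≥ 2
-- the coordinate kernels are σ-stable subalgebras different from σ whose intersection is σ, so
-- σ would not be irreducible.

module Submission where

open import Defs
open import Algebra.Bundles using (CommutativeMonoid)
import Algebra.Construct.Pointwise as Pointwise
import Algebra.Properties.CommutativeMonoid.Sum as CommutativeMonoidSum
import Algebra.Solver.CommutativeMonoid as CommutativeMonoidSolver
open import Data.Bool using (true)
open import Data.Empty using (⊥-elim)
open import Data.Fin using (Fin; zero; suc; toℕ; fromℕ; punchIn; _≟_)
open import Data.Fin.Properties using (toℕ-injective; toℕ-fromℕ<; toℕ-fromℕ; toℕ<n; punchInᵢ≢i)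
open import Data.List using ([]; _∷_; allFin)
open import Data.List.Membership.Propositional using (_∉_)
open import Data.List.Membership.Propositional.Properties using (∈-allFin)
open import Data.List.Relation.Unary.Any using (here; there)
open import Data.Nat using (ℕ; zero; suc; _+_; _∸_; _%_; NonZero; NonTrivial; 2+)
open import Data.Nat.DivMod using (_mod_; %-distribˡ-+; [m+n]%n≡m%n; m%n%n≡m%n; m<n⇒m%n≡m)
open import Data.Nat.Primality using (Prime; prime⇒nonZero; prime⇒nonTrivial)
open import Data.Nat.Properties using (+-assoc; +-comm; +-identityʳ; m+[n∸m]≡n; <⇒≤)
open import Data.Product using (Σ; _×_; _,_; proj₁; proj₂; ∃; ∃₂)
open import Data.Vec using (Vec; []; _∷_; lookup; replicate)
open import Data.Vec.Properties using (lookup-replicate; tabulate∘lookup; tabulate-cong; ∷-injective)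
open import Data.Vec.Functional as Vector using (updateAt; removeAt)
open import Data.Vec.Functional.Properties using (updateAt-updates; updateAt-minimal)
open import Function using (_∘_; const; _⇔_; mk⇔; Equivalence)
import Function.Properties.Equivalence as ⇔
open import Level using (0ℓ)
open import Relation.Binary.PropositionalEquality using (_≡_; _≢_; refl; sym; trans; cong; cong₂; subst₂; module ≡-Reasoning)
open import Relation.Nullary using (¬_; Dec; yes; no)
open import Relation.Nullary.Decidable using (⌊_⌋)
open import Relation.Nullary.Negation using (contradiction)

at-const : ∀ {n} {A : Set} (x : A) (i j : Fin n) → at x i x j ≡ x
at-const x i j with j ≟ i
... | yes _ = refl
... | no _ = refl

sumFin-cong : ∀ n {f g : Fin n → ℕ} → (∀ i → f i ≡ g i) → sumFin n f ≡ sumFin n g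
sumFin-cong zero    f≗g = refl
sumFin-cong (suc n) f≗g = cong₂ _+_ (f≗g zero) (sumFin-cong n (f≗g ∘ suc))

⌊⌋≡true⇔ : ∀ {A : Set} (a? : Dec A) → ⌊ a? ⌋ ≡ true ⇔ A
⌊⌋≡true⇔ (yes a) = mk⇔ (const a) (const refl)
⌊⌋≡true⇔ (no ¬a) = mk⇔ (λ ()) (λ a → contradiction a ¬a)

lookup-extensionality : ∀ {A : Set} {k} {u v : Vec A k} → (∀ j → lookup u j ≡ lookup v j) → u ≡ v
lookup-extensionality {u = u} {v} u≗v =
  trans (sym (tabulate∘lookup u)) (trans (tabulate-cong u≗v) (tabulate∘lookup v))

lookup-not-injective : ∀ {A : Set} {a b : A} {k} → a ≢ b → (j : Fin (2+ k)) →
  ∃₂ λ (u v : Vec A (2+ k)) → lookup u j ≡ lookup v j × u ≢ v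
lookup-not-injective {a = a} {b} a≢b zero =
  a ∷ a ∷ replicate _ a , a ∷ b ∷ replicate _ a , refl , a≢b ∘ proj₁ ∘ ∷-injective ∘ proj₂ ∘ ∷-injective
lookup-not-injective {a = a} {b} a≢b (suc j) =
  a ∷ replicate _ a , b ∷ replicate _ a , refl , a≢b ∘ proj₁ ∘ ∷-injective

Fin-two-distinct : ∀ p → .{{NonTrivial p}} → ∃₂ λ (a b : Fin p) → a ≢ b
Fin-two-distinct (2+ _) = zero , suc zero , λ ()

Preserves₄ : ∀ {n m ℓ} → Op n m → (Fin m → Fin m → Fin m → Fin m → Set ℓ) → Set ℓ
Preserves₄ {n} w R = ∀ a b c d → (∀ (i : Fin n) → R (a i) (b i) (c i) (d i)) → R (w a) (w b) (w c) (w d)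

record Saturation {m} (σ : Rel₂ m) (S : Rel₄ m) (a₁ a₂ a₃ a₄ : Fin m) : Set where
  constructor saturated
  field
    b₁ b₂ b₃ b₄ : Fin m
    σ₁ : σ a₁ b₁ ≡ true
    σ₂ : σ a₂ b₂ ≡ true
    σ₃ : σ a₃ b₃ ≡ true
    σ₄ : σ a₄ b₄ ≡ true
    S-holds : S b₁ b₂ b₃ b₄ ≡ true

saturation-preserved : ∀ {n m} {w : Op n m} {σ : Rel₂ m} {S : Rel₄ m} →
  IsSub₂ w σ → IsSub₄ w S → Preserves₄ w (Saturation σ S)
saturation-preserved {w = w} σ-sub S-sub a₁ a₂ a₃ a₄ sat = record
  { b₁ = w (b₁ ∘ sat) ; b₂ = w (b₂ ∘ sat) ; b₃ = w (b₃ ∘ sat) ; b₄ = w (b₄ ∘ sat)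
  ; σ₁ = σ-sub a₁ _ (σ₁ ∘ sat)
  ; σ₂ = σ-sub a₂ _ (σ₂ ∘ sat)
  ; σ₃ = σ-sub a₃ _ (σ₃ ∘ sat)
  ; σ₄ = σ-sub a₄ _ (σ₄ ∘ sat)
  ; S-holds = S-sub _ _ _ _ (S-holds ∘ sat)
  }
  where open Saturation

nullary⇒compatible-total : ∀ {m} {w : Op 0 m} {R : Rel₂ m} → InV 0 m w → IsSub₂ w R →
  ∀ x y → R x y ≡ true
nullary⇒compatible-total {R = R} w∈V R-sub x y =
  subst₂ (λ a b → R a b ≡ true) (idem x) (idem y) (R-sub (const x) (const y) λ ())
  where open InV w∈V

Parallelogram : ∀ {c ℓ} {A : Set} (M : CommutativeMonoid c ℓ) →
  (A → CommutativeMonoid.Carrier M) → A → A → A → A → Set ℓ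
Parallelogram M f a b c d = f a ∙ f d ≈ f b ∙ f c
  where open CommutativeMonoid M

module IdempotentSpecialWNU
  {c ℓ} (M : CommutativeMonoid c ℓ) {n m} {w : Op (suc n) m} (w∈V : InV (suc n) m w)
  (f : Fin m → CommutativeMonoid.Carrier M) {z : Fin m}
  (f[z]≈ε : CommutativeMonoid._≈_ M (f z) (CommutativeMonoid.ε M))
  (w-parallelogram : Preserves₄ w (Parallelogram M f))
  where

  open CommutativeMonoid M renaming (refl to ≈-refl; sym to ≈-sym; trans to ≈-trans)
  open CommutativeMonoidSum M using (sum; sum-cong-≋; sum-cong-≗; sum-remove; sum-replicate-zero)
  open InV w∈V
  open import Relation.Binary.Reasoning.Setoid setoid

  L : Fin m → Fin m
  L = w ∘ at z (fromℕ n)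

  copies : Carrier → Vector.Vector Carrier (suc n)
  copies = Vector.replicate (suc n)

  clear : (Fin (suc n) → Fin m) → Fin (suc n) → Fin (suc n) → Fin m
  clear u i = updateAt u i (const z)

  f∘w[z̄]≈ε : f (w (const z)) ≈ ε
  f∘w[z̄]≈ε = ≈-trans (reflexive (cong f (idem z))) f[z]≈ε

  f∘w≈ε : ∀ u → (∀ i → u i ≡ z) → f (w u) ≈ ε
  f∘w≈ε u u≡z = begin
    f (w u)                            ≈⟨ identityʳ _ ⟨
    f (w u) ∙ ε                        ≈⟨ ∙-congˡ f∘w[z̄]≈ε ⟨
    f (w u) ∙ f (w (const z))          ≈⟨ w-parallelogram u (const z) (const z) (const z) u≈z ⟩
    f (w (const z)) ∙ f (w (const z))  ≈⟨ ∙-cong f∘w[z̄]≈ε f∘w[z̄]≈ε ⟩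
    ε ∙ ε                              ≈⟨ identityʳ ε ⟩
    ε                                  ∎
    where
    u≈z : ∀ i → Parallelogram M f (u i) z z z
    u≈z i = reflexive (cong (λ x → f x ∙ f z) (u≡z i))

  f∘L[z]≈ε : f (L z) ≈ ε
  f∘L[z]≈ε = f∘w≈ε (at z (fromℕ n) z) (at-const z (fromℕ n))

  f∘w-split : ∀ u i → f (w u) ≈ f (w (clear u i)) ∙ f (L (u i))
  f∘w-split u i = begin
    f (w u)                                   ≈⟨ identityʳ _ ⟨
    f (w u) ∙ ε                               ≈⟨ ∙-congˡ f∘w[z̄]≈ε ⟨
    f (w u) ∙ f (w (const z))                 ≈⟨ w-parallelogram u (clear u i) (at z i (u i)) (const z) split ⟩
    f (w (clear u i)) ∙ f (w (at z i (u i)))  ≡⟨ cong (λ x → f (w (clear u i)) ∙ f x) (wnu z (u i) i (fromℕ n)) ⟩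
    f (w (clear u i)) ∙ f (L (u i))           ∎
    where
    split : ∀ j → Parallelogram M f (u j) (clear u i j) (at z i (u i) j) z
    -- matching on j ≟ i also evaluates at z i (u i) j, which is defined by that test
    split j with j ≟ i
    ... | yes refl = ≈-trans (comm _ _) (reflexive (cong (λ x → f x ∙ f (u j)) (sym (updateAt-updates j u))))
    ... | no j≢i = reflexive (cong (λ x → f x ∙ f z) (sym (updateAt-minimal j i u j≢i)))

  sum-clear : ∀ (F : Fin m → Carrier) → F z ≈ ε → ∀ u i → sum (F ∘ clear u i) ∙ F (u i) ≈ sum (F ∘ u)
  sum-clear F F[z]≈ε u i = begin
    sum (F ∘ clear u i) ∙ F (u i)                                  ≈⟨ ∙-congʳ (sum-remove {i = i} (F ∘ clear u i)) ⟩
    (F (clear u i i) ∙ sum (removeAt (F ∘ clear u i) i)) ∙ F (u i) ≡⟨ cong₂ (λ x y → (F x ∙ y) ∙ F (u i))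
                                                                        (updateAt-updates i u) (sum-cong-≗ unchanged) ⟩
    (F z ∙ rest) ∙ F (u i)                                         ≈⟨ ∙-congʳ (≈-trans (∙-congʳ F[z]≈ε) (identityˡ rest)) ⟩
    rest ∙ F (u i)                                                 ≈⟨ comm rest (F (u i)) ⟩
    F (u i) ∙ rest                                                 ≈⟨ sum-remove {i = i} (F ∘ u) ⟨
    sum (F ∘ u)                                                    ∎
    where
    rest : Carrier
    rest = sum (removeAt (F ∘ u) i)
    unchanged : ∀ j → removeAt (F ∘ clear u i) i j ≡ removeAt (F ∘ u) i j
    unchanged j = cong F (updateAt-minimal (punchIn i j) i u (punchInᵢ≢i i j))

  f∘w≈sum∘L-supported : ∀ is u → (∀ i → i ∉ is → u i ≡ z) → f (w u) ≈ sum (f ∘ L ∘ u)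
  f∘w≈sum∘L-supported [] u supp = begin
    f (w u)                           ≈⟨ f∘w≈ε u (λ i → supp i λ ()) ⟩
    ε                                 ≈⟨ sum-replicate-zero (suc n) ⟨
    sum (copies ε)                    ≈⟨ sum-cong-≋ (λ i → ≈-trans (reflexive (cong (f ∘ L) (supp i λ ()))) f∘L[z]≈ε) ⟨
    sum (f ∘ L ∘ u)                   ∎
  f∘w≈sum∘L-supported (i ∷ is) u supp = begin
    f (w u)                                ≈⟨ f∘w-split u i ⟩
    f (w (clear u i)) ∙ f (L (u i))        ≈⟨ ∙-congʳ (f∘w≈sum∘L-supported is (clear u i) supp′) ⟩
    sum (f ∘ L ∘ clear u i) ∙ f (L (u i))  ≈⟨ sum-clear (f ∘ L) f∘L[z]≈ε u i ⟩
    sum (f ∘ L ∘ u)                        ∎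
    where
    supp′ : ∀ j → j ∉ is → clear u i j ≡ z
    supp′ j j∉is with j ≟ i
    ... | yes refl = updateAt-updates j u
    ... | no j≢i = trans (updateAt-minimal j i u j≢i) (supp j λ { (here j≡i) → j≢i j≡i ; (there j∈is) → j∉is j∈is })

  f∘w≈sum∘L : ∀ u → f (w u) ≈ sum (f ∘ L ∘ u)
  f∘w≈sum∘L u = f∘w≈sum∘L-supported (allFin _) u (λ i i∉ → contradiction (∈-allFin i) i∉)

  f≈sum∘L : ∀ y → f y ≈ sum (copies (f (L y)))
  f≈sum∘L y = ≈-trans (reflexive (cong f (sym (idem y)))) (f∘w≈sum∘L (const y))

  f∘L≈f : ∀ v → f (L v) ≈ f v
  f∘L≈f v = begin
    f (L v)                     ≈⟨ f≈sum∘L (L v) ⟩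
    sum (copies (f (L (L v))))  ≡⟨ cong (sum ∘ copies ∘ f) L≡L∘L ⟨
    sum (copies (f (L v)))      ≈⟨ f≈sum∘L v ⟨
    f v                         ∎
    where
    L≡L∘L : L v ≡ L (L v)
    L≡L∘L = special z v (fromℕ n) (cong suc (toℕ-fromℕ n))

  f∘w≈sum : ∀ u → f (w u) ≈ sum (f ∘ u)
  f∘w≈sum u = ≈-trans (f∘w≈sum∘L u) (sum-cong-≋ (f∘L≈f ∘ u))

module _ {c ℓ} (M : CommutativeMonoid c ℓ) where
  open CommutativeMonoid M renaming (refl to ≈-refl; sym to ≈-sym; trans to ≈-trans)
  open CommutativeMonoidSolver M using (solve; _⊕_; _⊜_)
  open import Relation.Binary.Reasoning.Setoid setoid

  parallelogram-via-inverses : ∀ {x y b b′ d d′} → b ∙ b′ ≈ ε → d ∙ d′ ≈ ε →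
    x ∙ b′ ≈ y ∙ d′ ⇔ x ∙ d ≈ b ∙ y
  parallelogram-via-inverses {x} {y} {b} {b′} {d} {d′} bb′≈ε dd′≈ε = mk⇔ to from
    where
    absorb : ∀ {u e} → e ≈ ε → u ≈ u ∙ e
    absorb {u} e≈ε = ≈-sym (≈-trans (∙-congˡ e≈ε) (identityʳ u))
    to : x ∙ b′ ≈ y ∙ d′ → x ∙ d ≈ b ∙ y
    to h = begin
      x ∙ d                ≈⟨ absorb bb′≈ε ⟩
      (x ∙ d) ∙ (b ∙ b′)   ≈⟨ solve 4 (λ x d b b′ → (x ⊕ d) ⊕ (b ⊕ b′) ⊜ (x ⊕ b′) ⊕ (b ⊕ d)) ≈-refl x d b b′ ⟩
      (x ∙ b′) ∙ (b ∙ d)   ≈⟨ ∙-congʳ h ⟩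
      (y ∙ d′) ∙ (b ∙ d)   ≈⟨ solve 4 (λ y d′ b d → (y ⊕ d′) ⊕ (b ⊕ d) ⊜ (b ⊕ y) ⊕ (d ⊕ d′)) ≈-refl y d′ b d ⟩
      (b ∙ y) ∙ (d ∙ d′)   ≈⟨ absorb dd′≈ε ⟨
      b ∙ y                ∎
    from : x ∙ d ≈ b ∙ y → x ∙ b′ ≈ y ∙ d′
    from h = begin
      x ∙ b′                ≈⟨ absorb dd′≈ε ⟩
      (x ∙ b′) ∙ (d ∙ d′)   ≈⟨ solve 4 (λ x b′ d d′ → (x ⊕ b′) ⊕ (d ⊕ d′) ⊜ (x ⊕ d) ⊕ (b′ ⊕ d′)) ≈-refl x b′ d d′ ⟩
      (x ∙ d) ∙ (b′ ∙ d′)   ≈⟨ ∙-congʳ h ⟩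
      (b ∙ y) ∙ (b′ ∙ d′)   ≈⟨ solve 4 (λ b y b′ d′ → (b ⊕ y) ⊕ (b′ ⊕ d′) ⊜ (y ⊕ d′) ⊕ (b ⊕ b′)) ≈-refl b y b′ d′ ⟩
      (y ∙ d′) ∙ (b ∙ b′)   ≈⟨ absorb bb′≈ε ⟨
      y ∙ d′                ∎

module _ (p : ℕ) .{{_ : NonZero p}} where

  ℕ-mod-commutativeMonoid : CommutativeMonoid 0ℓ 0ℓ
  ℕ-mod-commutativeMonoid = record
    { Carrier = ℕ
    ; _≈_ = λ a b → a % p ≡ b % p
    ; _∙_ = _+_
    ; ε = 0
    ; isCommutativeMonoid = record
      { isMonoid = record
        { isSemigroup = record
          { isMagma = record
            { isEquivalence = record { refl = refl ; sym = sym ; trans = trans }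
            ; ∙-cong = +-cong
            }
          ; assoc = λ a b c → cong (_% p) (+-assoc a b c)
          }
        ; identity = (λ _ → refl) , (λ a → cong (_% p) (+-identityʳ a))
        }
      ; comm = λ a b → cong (_% p) (+-comm a b)
      }
    }
    where
    +-cong : ∀ {a b c d} → a % p ≡ b % p → c % p ≡ d % p → (a + c) % p ≡ (b + d) % p
    +-cong {a} {b} {c} {d} a≈b c≈d = begin
      (a + c) % p              ≡⟨ %-distribˡ-+ a c p ⟩
      (a % p + c % p) % p      ≡⟨ cong₂ (λ x y → (x + y) % p) a≈b c≈d ⟩
      (b % p + d % p) % p      ≡⟨ %-distribˡ-+ b d p ⟨
      (b + d) % p              ∎
      where open ≡-Reasoning

  zsub≡zsub⇔ : ∀ (a b c d : Fin p) →
    zsub p a b ≡ zsub p c d ⇔ (toℕ a + toℕ d) % p ≡ (toℕ b + toℕ c) % p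
  zsub≡zsub⇔ a b c d = ⇔.trans toℕ-zsub-equation
    (parallelogram-via-inverses ℕ-mod-commutativeMonoid {toℕ a} {toℕ c} {toℕ b} {p ∸ toℕ b} {toℕ d} {p ∸ toℕ d}
      (∸-inverse b) (∸-inverse d))
    where
    ∸-inverse : ∀ (x : Fin p) → (toℕ x + (p ∸ toℕ x)) % p ≡ 0 % p
    ∸-inverse x = trans (cong (_% p) (m+[n∸m]≡n (<⇒≤ (toℕ<n x)))) ([m+n]%n≡m%n 0 p)
    toℕ-zsub : ∀ x y → toℕ (zsub p x y) ≡ (toℕ x + (p ∸ toℕ y)) % p
    toℕ-zsub x y = toℕ-fromℕ< _
    toℕ-zsub-equation : zsub p a b ≡ zsub p c d ⇔
      (toℕ a + (p ∸ toℕ b)) % p ≡ (toℕ c + (p ∸ toℕ d)) % p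
    toℕ-zsub-equation = mk⇔
      (λ e → trans (sym (toℕ-zsub a b)) (trans (cong toℕ e) (toℕ-zsub c d)))
      (λ e → toℕ-injective (trans (toℕ-zsub a b) (trans e (sym (toℕ-zsub c d)))))

module _ {p : ℕ} (pr : Prime p) where
  private instance
    p≢0 : NonZero p
    p≢0 = prime⇒nonZero pr

  ZsubParallelogram : ∀ {m k} → (Fin m → Vec (Fin p) k) → Fin m → Fin m → Fin m → Fin m → Set
  ZsubParallelogram φ a b c d =
    ∀ j → zsub p (lookup (φ a) j) (lookup (φ b) j) ≡ zsub p (lookup (φ c) j) (lookup (φ d) j)

  zsub-coordinates-are-homomorphisms : ∀ {n m k} {w : Op (suc n) m} → InV (suc n) m w →
    (φ : Fin m → Vec (Fin p) k) → ∀ {z} → φ z ≡ replicate k (0 mod p) →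
    Preserves₄ w (ZsubParallelogram φ) →
    ∀ u j → lookup (φ (w u)) j ≡ zpOp p (λ i → lookup (φ (u i)) j)
  zsub-coordinates-are-homomorphisms {n} {m} {k} {w} w∈V φ {z} φ[z]≡0 w-zsub u j = toℕ-injective (begin
    toℕ (lookup (φ (w u)) j)                 ≡⟨ m<n⇒m%n≡m (toℕ<n _) ⟨
    toℕ (lookup (φ (w u)) j) % p             ≡⟨ f∘w≈sum u j ⟩
    sum (f ∘ u) j % p                        ≡⟨ cong (_% p) (sum-lookup (f ∘ u) j) ⟩
    sumFin (suc n) (λ i → f (u i) j) % p     ≡⟨ toℕ-fromℕ< _ ⟨
    toℕ (zpOp p (λ i → lookup (φ (u i)) j))  ∎)
    where
    open ≡-Reasoning
    Mᵏ : CommutativeMonoid 0ℓ 0ℓ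
    Mᵏ = Pointwise.commutativeMonoid (Fin k) (ℕ-mod-commutativeMonoid p)
    open CommutativeMonoidSum Mᵏ using (sum)

    f : Fin m → Fin k → ℕ
    f x j = toℕ (lookup (φ x) j)

    f[z]≈ε : ∀ j → f z j % p ≡ 0 % p
    f[z]≈ε j = begin
      toℕ (lookup (φ z) j) % p                       ≡⟨ cong (λ v → toℕ (lookup v j) % p) φ[z]≡0 ⟩
      toℕ (lookup (replicate k (0 mod p)) j) % p     ≡⟨ cong (λ x → toℕ x % p) (lookup-replicate j (0 mod p)) ⟩
      toℕ (0 mod p) % p                              ≡⟨ cong (_% p) (toℕ-fromℕ< _) ⟩
      0 % p % p                                      ≡⟨ m%n%n≡m%n 0 p ⟩
      0 % p                                          ∎

    f-parallelogram : Preserves₄ w (Parallelogram Mᵏ f)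
    f-parallelogram a b c d h j = Equivalence.to (coordinate⇔ (w a) (w b) (w c) (w d) j)
      (w-zsub a b c d (λ i j → Equivalence.from (coordinate⇔ (a i) (b i) (c i) (d i) j) (h i j)) j)
      where
      coordinate⇔ : ∀ x y x′ y′ j →
        zsub p (lookup (φ x) j) (lookup (φ y) j) ≡ zsub p (lookup (φ x′) j) (lookup (φ y′) j) ⇔
        (f x j + f y′ j) % p ≡ (f y j + f x′ j) % p
      coordinate⇔ x y x′ y′ j =
        zsub≡zsub⇔ p (lookup (φ x) j) (lookup (φ y) j) (lookup (φ x′) j) (lookup (φ y′) j)

    open IdempotentSpecialWNU Mᵏ w∈V f f[z]≈ε f-parallelogram using (f∘w≈sum)

    sum-lookup : ∀ {N} (F : Fin N → Fin k → ℕ) j → sum F j ≡ sumFin N (λ i → F i j)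
    sum-lookup {zero} F j = refl
    sum-lookup {suc N} F j = cong (F zero j +_) (sum-lookup (F ∘ suc) j)

  record LinearCoordinates {n m} (w : Op n m) (σ : Rel₂ m) (k : ℕ) : Set where
    field
      φ : Fin m → Vec (Fin p) k
      φ-cong : ∀ x y → σ x y ≡ true → φ x ≡ φ y
      φ-injective : ∀ x y → φ x ≡ φ y → σ x y ≡ true
      φ-surjective : ∀ v → ∃ λ x → φ x ≡ v
      w-zsub : Preserves₄ w (ZsubParallelogram φ)

  blockIso⇒linearCoordinates : ∀ {n m} {w : Op n m} {σ δ : Rel₂ m} {S : Rel₄ m} {e k} →
    (∀ x → δ e x ≡ true) → IsCongruence w σ → IsSub₄ w S →
    BlockIso σ δ S e p pr k → LinearCoordinates w σ k
  blockIso⇒linearCoordinates {σ = σ} {S = S} block-total σ-cong S-sub (φ , φ-cong , φ-inj , φ-surj , φ-zsub) = record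
    { φ = φ
    ; φ-cong = λ x y → φ-cong x y (block-total x) (block-total y)
    ; φ-injective = λ x y → φ-inj x y (block-total x) (block-total y)
    ; φ-surjective = λ v → proj₁ (φ-surj v) , proj₂ (proj₂ (φ-surj v))
    ; w-zsub = λ a₁ a₂ a₃ a₄ h → Equivalence.to (saturation⇔zsub _ _ _ _)
        (saturation-preserved (IsCongruence.compatible σ-cong) S-sub a₁ a₂ a₃ a₄
          (λ i → Equivalence.from (saturation⇔zsub _ _ _ _) (h i)))
    }
    where
    saturation⇔zsub : ∀ a₁ a₂ a₃ a₄ → Saturation σ S a₁ a₂ a₃ a₄ ⇔ ZsubParallelogram φ a₁ a₂ a₃ a₄
    saturation⇔zsub a₁ a₂ a₃ a₄
      with φ-zsub a₁ a₂ a₃ a₄ (block-total a₁) (block-total a₂) (block-total a₃) (block-total a₄)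
    ... | to , from = mk⇔
      (λ (saturated b₁ b₂ b₃ b₄ s₁ s₂ s₃ s₄ s) → to
        (b₁ , b₂ , b₃ , b₄ , block-total b₁ , block-total b₂ , block-total b₃ , block-total b₄ ,
         s₁ , s₂ , s₃ , s₄ , s))
      (λ h → let (b₁ , b₂ , b₃ , b₄ , _ , _ , _ , _ , s₁ , s₂ , s₃ , s₄ , s) = from h
             in saturated b₁ b₂ b₃ b₄ s₁ s₂ s₃ s₄ s)

  coordinate-homomorphism : ∀ {n m k} {w : Op (suc n) m} {σ : Rel₂ m} → InV (suc n) m w →
    (C : LinearCoordinates w σ k) → let open LinearCoordinates C in
    ∀ u j → lookup (φ (w u)) j ≡ zpOp p (λ i → lookup (φ (u i)) j)
  coordinate-homomorphism {k = k} w∈V C = zsub-coordinates-are-homomorphisms w∈V φ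
    (proj₂ (φ-surjective (replicate k (0 mod p)))) w-zsub
    where open LinearCoordinates C

  zero-dimensional⇒total : ∀ {n m} {w : Op n m} {σ : Rel₂ m} → LinearCoordinates w σ 0 →
    ∀ x y → σ x y ≡ true
  zero-dimensional⇒total C x y = φ-injective x y (lookup-extensionality λ ())
    where open LinearCoordinates C

  one-dimensional⇒QuotIsoZp : ∀ {n m} {w : Op (suc n) m} {σ : Rel₂ m} → InV (suc n) m w →
    LinearCoordinates w σ 1 → QuotIsoZp w σ p pr
  one-dimensional⇒QuotIsoZp {m = m} w∈V C =
    coordinate ,
    (λ x y → cong (λ v → lookup v zero) ∘ φ-cong x y) ,
    (λ x y e → φ-injective x y (lookup-extensionality λ { zero → e })) ,
    (λ a → proj₁ (φ-surjective (a ∷ [])) , cong (λ v → lookup v zero) (proj₂ (φ-surjective (a ∷ [])))) ,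
    (λ u → coordinate-homomorphism w∈V C u zero)
    where
    open LinearCoordinates C
    coordinate : Fin m → Fin p
    coordinate x = lookup (φ x) zero

  higher-dimensional⇒¬irreducible : ∀ {n m k} {w : Op (suc n) m} {σ : Rel₂ m} → InV (suc n) m w →
    LinearCoordinates w σ (2+ k) → ¬ Irreducible w σ
  higher-dimensional⇒¬irreducible {n} {m} {k} {w} {σ} w∈V C irreducible =
    irreducible (Fin (2+ k) , kernel , kernel-sub , kernel-stable , kernel≠σ , ⋂kernel≡σ)
    where
    open LinearCoordinates C
    open ≡-Reasoning

    kernel : Fin (2+ k) → Rel₂ m
    kernel j x y = ⌊ lookup (φ x) j ≟ lookup (φ y) j ⌋

    kernel⇔ : ∀ j x y → kernel j x y ≡ true ⇔ lookup (φ x) j ≡ lookup (φ y) j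
    kernel⇔ j x y = ⌊⌋≡true⇔ (lookup (φ x) j ≟ lookup (φ y) j)

    kernel-sub : ∀ j → IsSub₂ w (kernel j)
    kernel-sub j a b ab = Equivalence.from (kernel⇔ j (w a) (w b)) (begin
      lookup (φ (w a)) j                   ≡⟨ coordinate-homomorphism w∈V C a j ⟩
      zpOp p (λ i → lookup (φ (a i)) j)    ≡⟨ cong (_mod p) (sumFin-cong (suc n) (cong toℕ ∘ same)) ⟩
      zpOp p (λ i → lookup (φ (b i)) j)    ≡⟨ coordinate-homomorphism w∈V C b j ⟨
      lookup (φ (w b)) j                   ∎)
      where
      same : ∀ i → lookup (φ (a i)) j ≡ lookup (φ (b i)) j
      same i = Equivalence.to (kernel⇔ j (a i) (b i)) (ab i)

    kernel-stable : ∀ j → Stable σ (kernel j)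
    kernel-stable j x y x′ y′ σxx′ σyy′ =
      subst₂ (λ u v → ⌊ lookup u j ≟ lookup v j ⌋ ≡ true) (φ-cong x x′ σxx′) (φ-cong y y′ σyy′)

    kernel≠σ : ∀ j → ¬ (kernel j ⊆₂ σ × σ ⊆₂ kernel j)
    kernel≠σ j (kernel⊆σ , _) =
      let (a , b , a≢b) = Fin-two-distinct p {{prime⇒nonTrivial pr}}
          (u , v , u[j]≡v[j] , u≢v) = lookup-not-injective a≢b j
          (x , φx≡u) = φ-surjective u
          (y , φy≡v) = φ-surjective v
          φx[j]≡φy[j] : lookup (φ x) j ≡ lookup (φ y) j
          φx[j]≡φy[j] = begin
            lookup (φ x) j  ≡⟨ cong (λ t → lookup t j) φx≡u ⟩
            lookup u j      ≡⟨ u[j]≡v[j] ⟩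
            lookup v j      ≡⟨ cong (λ t → lookup t j) φy≡v ⟨
            lookup (φ y) j  ∎
      in u≢v (begin
        u    ≡⟨ φx≡u ⟨
        φ x  ≡⟨ φ-cong x y (kernel⊆σ x y (Equivalence.from (kernel⇔ j x y) φx[j]≡φy[j])) ⟩
        φ y  ≡⟨ φy≡v ⟩
        v    ∎)

    ⋂kernel≡σ : ∀ x y → (σ x y ≡ true → ∀ j → kernel j x y ≡ true) × ((∀ j → kernel j x y ≡ true) → σ x y ≡ true)
    ⋂kernel≡σ x y =
      (λ σxy j → Equivalence.from (kernel⇔ j x y) (cong (λ t → lookup t j) (φ-cong x y σxy))) ,
      (λ all → φ-injective x y (lookup-extensionality (λ j → Equivalence.to (kernel⇔ j x y) (all j))))

lemma2p7 : (n m : ℕ) (w : Op n m) → InV n m w →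
    (σ δ : Rel₂ m) → IsCongruence w σ → Linear w σ δ →
    (∀ x y → δ x y ≡ true) →
    Σ ℕ λ p → Σ (Prime p) λ pr → QuotIsoZp w σ p pr
lemma2p7 n zero w w∈V σ δ σ-cong (_ , (_ , _ , _ , δ⊈σ , _) , _) δ-total = ⊥-elim (δ⊈σ λ ())
lemma2p7 zero (suc m) w w∈V σ δ σ-cong (_ , (_ , _ , _ , δ⊈σ , _) , _) δ-total =
  ⊥-elim (δ⊈σ λ x y _ → nullary⇒compatible-total w∈V (IsCongruence.compatible σ-cong) x y)
lemma2p7 (suc n) (suc m) w w∈V σ δ σ-cong
  (irreducible , (_ , _ , _ , δ⊈σ , _) , _ , p , pr , S , S-sub , _ , blocks) δ-total =
  p , pr , by-dimension (blocks zero)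
  where
  coordinates : ∀ {k} → BlockIso σ δ S zero p pr k → LinearCoordinates pr w σ k
  coordinates = blockIso⇒linearCoordinates pr {δ = δ} (δ-total zero) σ-cong S-sub

  by-dimension : Σ ℕ (BlockIso σ δ S zero p pr) → QuotIsoZp w σ p pr
  by-dimension (0 , iso) = ⊥-elim (δ⊈σ λ x y _ → zero-dimensional⇒total pr (coordinates iso) x y)
  by-dimension (1 , iso) = one-dimensional⇒QuotIsoZp pr w∈V (coordinates iso)
  by-dimension (2+ k , iso) = ⊥-elim (higher-dimensional⇒¬irreducible pr w∈V (coordinates iso) irreducible)
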